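{- Let $p$ be a prime, $s$ a positive integer, and let $f_1,\ldots,f_s$ be nonnegative integers such that the coefficient of the monomial $x_1^{f_1}\cdots x_s^{f_s}$ in the polynomial $\prod_{1\leq i<j\leq s}(x_j-x_i)^2$ is non-zero modulo $p$. Then the sequence $(pf_1,\ldots,pf_s)$ is satisfying for $n=p$ and $k=2$; that is, whenever $\mathcal F_1,\ldots,\mathcal F_s\subset[p]^2$ satisfy $|\mathcal F_i|>pf_i$ for all $i\in[s]$, there exist pairwise disjoint $F_1\in\mathcal F_1,\ldots,F_s\in\mathcal F_s$.
   Context: $[p]^2$ is the set of pairs $(x_1,x_2)$ with $x_1,x_2\in\{1,\ldots,p\}$ (equivalently, edges of the complete bipartite graph $K_{p,p}$). Two pairs $(x_1,x_2)$ and $(y_1,y_2)$ are disjoint iff $x_1\neq y_1$ and $x_2\neq y_2$. A sequence $(g_1,\ldots,g_s)$ is satisfying (for $n=p$, $k=2$) if for all families $\mathcal F_1,\ldots,\mathcal F_s\subset[p]^2$ with $|\mathcal F_i|>g_i$ for each $i$, there exist pairwise disjoint $F_1\in\mathcal F_1,\ldots,F_s\in\mathcal F_s$. -}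

module Defs where

open import Data.Nat using (ℕ; zero; suc)
open import Data.Integer as ℤ using (ℤ; +_; -_)
open import Data.Fin using (Fin; _<_)
open import Data.Fin.Properties using (_<?_)
open import Data.Vec as Vec using (Vec; replicate; zipWith; updateAt)
open import Data.Vec.Properties using (≡-dec)
open import Data.Nat.Properties using () renaming (_≟_ to _≟ℕ_)
open import Data.List as List using (List; []; _∷_; concatMap; map; foldr; allFin; filter)
open import Data.Product using (_×_; _,_)
open import Relation.Nullary using (¬_; yes; no)
open import Relation.Binary.PropositionalEquality using (_≡_)

-- Polynomials in s variables with integer coefficients, represented as a
-- (formal) sum of terms  c · x^e  with c : ℤ and exponent vector e : Vec ℕ s.
Poly : ℕ → Set
Poly s = List (ℤ × Vec ℕ s)

var : {s : ℕ} → Fin s → Poly s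
var {s} i = (+ 1 , updateAt (replicate s 0) i (λ _ → 1)) ∷ []

one : {s : ℕ} → Poly s
one {s} = (+ 1 , replicate s 0) ∷ []

_⊕_ : {s : ℕ} → Poly s → Poly s → Poly s
p ⊕ q = p List.++ q

⊖_ : {s : ℕ} → Poly s → Poly s
⊖ p = map (λ { (c , e) → (- c , e) }) p

_⊗_ : {s : ℕ} → Poly s → Poly s → Poly s
p ⊗ q = concatMap (λ { (c , e) → map (λ { (d , e') → (c ℤ.* d , zipWith Data.Nat._+_ e e') }) q }) p
  where import Data.Nat

coeff : {s : ℕ} → Vec ℕ s → Poly s → ℤ
coeff f [] = + 0
coeff f ((c , e) ∷ p) with ≡-dec _≟ℕ_ e f
... | yes _ = c ℤ.+ coeff f p
... | no _  = coeff f p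

pairsLt : (s : ℕ) → List (Fin s × Fin s)
pairsLt s = concatMap (λ j → map (λ i → (i , j)) (filter (λ i → i <? j) (allFin s))) (allFin s)

discPoly : (s : ℕ) → Poly s
discPoly s = foldr (λ { (i , j) acc → let d = var j ⊕ (⊖ var i) in (d ⊗ d) ⊗ acc }) one (pairsLt s)

Pair : ℕ → Set
Pair p = Fin p × Fin p

Disjoint : {p : ℕ} → Pair p → Pair p → Set
Disjoint (x₁ , x₂) (y₁ , y₂) = ¬ (x₁ ≡ y₁) × ¬ (x₂ ≡ y₂)

-- Every edge (a , b) of K_{p,p} lies on exactly one of the p diagonals b ≡ a + k (mod p), so a family
-- of more than p f_i edges contains f_i + 1 edges (a , a + k_i) on a common diagonal k_i, whose first
-- coordinates form a set T_i of f_i + 1 distinct residues. Edges (a_i , a_i + k_i), one per family,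
-- are pairwise disjoint iff P(a) = ∏_{i<j} (a_j - a_i) (a_j - a_i + k_j - k_i) ≢ 0 (mod p). Now P is
-- ∏_{i<j} (x_j - x_i)² plus terms of lower degree, and the nonzero coefficient forces ∑ f_i = deg P,
-- so the coefficient form of the Combinatorial Nullstellensatz,
--   ∑_{t ∈ T_1 × ⋯ × T_s} P(t) ∏_i ∏_{y ∈ T_i, y ≠ t_i} (t_i - y)⁻¹ ≡ [x^f] P  (mod p),
-- makes the left-hand side nonzero, hence P(t) ≢ 0 at some point t of the grid. In one variable the
-- formula is the divided-difference identity ∑_{x ∈ T} x^k / ∏_{y ≠ x} (x - y) = δ_{k, |T| - 1} for k < |T|.

module Submission where

open import Data.Nat using (ℕ)
open import Data.Nat.Primality using (Prime)
open import Defs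

module Sums where

  open import Data.Integer using (ℤ; _+_; _*_; 0ℤ; 1ℤ)
  import Data.Integer.Properties as ℤ
  open import Data.List using (List; []; _∷_; _++_; map; concatMap)
  open import Function using (_∘′_)
  open import Relation.Binary.PropositionalEquality using (_≡_; refl; sym; trans; cong; cong₂)
  open import Algebra.Properties.CommutativeSemigroup ℤ.+-commutativeSemigroup using () renaming (interchange to +-interchange)

  private variable A B : Set

  ∑ : List A → (A → ℤ) → ℤ
  ∑ []       f = 0ℤ
  ∑ (x ∷ xs) f = f x + ∑ xs f

  infix 5 ∑
  syntax ∑ xs (λ x → e) = ∑[ x ∈ xs ] e

  ∏ : List A → (A → ℤ) → ℤ
  ∏ []       f = 1ℤ
  ∏ (x ∷ xs) f = f x * ∏ xs f

  ∑-cong : ∀ (xs : List A) {f g : A → ℤ} → (∀ x → f x ≡ g x) → ∑ xs f ≡ ∑ xs g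
  ∑-cong []       f≡g = refl
  ∑-cong (x ∷ xs) f≡g = cong₂ _+_ (f≡g x) (∑-cong xs f≡g)

  ∑-++ : ∀ (xs ys : List A) f → ∑ (xs ++ ys) f ≡ ∑ xs f + ∑ ys f
  ∑-++ []       ys f = sym (ℤ.+-identityˡ (∑ ys f))
  ∑-++ (x ∷ xs) ys f = trans (cong (_+_ (f x)) (∑-++ xs ys f)) (sym (ℤ.+-assoc (f x) (∑ xs f) (∑ ys f)))

  ∑-map : ∀ (g : A → B) (xs : List A) f → ∑ (map g xs) f ≡ ∑ xs (f ∘′ g)
  ∑-map g []       f = refl
  ∑-map g (x ∷ xs) f = cong (_+_ (f (g x))) (∑-map g xs f)

  ∑-concatMap : ∀ (g : A → List B) (xs : List A) f → ∑ (concatMap g xs) f ≡ ∑[ x ∈ xs ] ∑ (g x) f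
  ∑-concatMap g []       f = refl
  ∑-concatMap g (x ∷ xs) f =
    trans (∑-++ (g x) (concatMap g xs) f) (cong (_+_ (∑ (g x) f)) (∑-concatMap g xs f))

  ∑-distrib-+ : ∀ (xs : List A) f g → ∑[ x ∈ xs ] (f x + g x) ≡ ∑ xs f + ∑ xs g
  ∑-distrib-+ []       f g = refl
  ∑-distrib-+ (x ∷ xs) f g =
    trans (cong (_+_ (f x + g x)) (∑-distrib-+ xs f g)) (+-interchange (f x) (g x) (∑ xs f) (∑ xs g))

  ∑-*ˡ : ∀ (xs : List A) a f → ∑[ x ∈ xs ] a * f x ≡ a * ∑ xs f
  ∑-*ˡ []       a f = sym (ℤ.*-zeroʳ a)
  ∑-*ˡ (x ∷ xs) a f = trans (cong (_+_ (a * f x)) (∑-*ˡ xs a f)) (sym (ℤ.*-distribˡ-+ a (f x) (∑ xs f)))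

  ∑-*ʳ : ∀ (xs : List A) a f → ∑[ x ∈ xs ] f x * a ≡ ∑ xs f * a
  ∑-*ʳ xs a f = trans (∑-cong xs (λ x → ℤ.*-comm (f x) a)) (trans (∑-*ˡ xs a f) (ℤ.*-comm a (∑ xs f)))

module Congruence (p : ℕ) where

  open import Data.Integer using (ℤ; +_; -_; _+_; _-_; _*_; 0ℤ)
  import Data.Integer.Properties as ℤ
  open import Data.Integer.Divisibility.Signed using (_∣_; divides; _∣?_; ∣m∣n⇒∣m+n; ∣m⇒∣-m; ∣n⇒∣m*n)
  open import Data.Integer.Tactic.RingSolver using (solve-∀)
  open import Data.List using (List; []; _∷_)
  open import Data.List.Membership.Propositional using (_∈_)
  open import Data.List.Relation.Unary.All using (All; []; _∷_)
  open import Data.List.Relation.Unary.Any using (here; there)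
  open import Data.Product using (∃-syntax; _×_; _,_)
  open import Function using (_∘_)
  open import Level using (0ℓ)
  open import Relation.Binary.Bundles using (Setoid)
  import Relation.Binary.Reasoning.Setoid as SetoidReasoning
  open import Relation.Binary.PropositionalEquality using (_≡_; refl; sym)
  open import Relation.Nullary using (¬_; Dec; yes; no; contradiction)
  import Relation.Nullary.Decidable as Dec
  open Sums

  infix 4 _≈_ _≉_

  record _≈_ (a b : ℤ) : Set where
    constructor mk≈
    field divides-difference : + p ∣ a - b

  _≉_ : ℤ → ℤ → Set
  a ≉ b = ¬ a ≈ b

  private
    ∣-≡ : ∀ {x y} → x ≡ y → + p ∣ y → + p ∣ x
    ∣-≡ refl p∣y = p∣y

  ≈-reflexive : ∀ {a b} → a ≡ b → a ≈ b
  ≈-reflexive {a} refl = mk≈ (∣-≡ (ℤ.+-inverseʳ a) (divides 0ℤ refl))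

  ≈-refl : ∀ {a} → a ≈ a
  ≈-refl {a} = ≈-reflexive {a} refl

  ≈-sym : ∀ {a b} → a ≈ b → b ≈ a
  ≈-sym {a} {b} (mk≈ p∣a-b) = mk≈ (∣-≡ (flip a b) (∣m⇒∣-m p∣a-b))
    where flip : ∀ a b → b - a ≡ - (a - b)
          flip = solve-∀

  ≈-trans : ∀ {a b c} → a ≈ b → b ≈ c → a ≈ c
  ≈-trans {a} {b} {c} (mk≈ p∣a-b) (mk≈ p∣b-c) = mk≈ (∣-≡ (telescope a b c) (∣m∣n⇒∣m+n p∣a-b p∣b-c))
    where telescope : ∀ a b c → a - c ≡ (a - b) + (b - c)
          telescope = solve-∀

  ≉-sym : ∀ {a b} → a ≉ b → b ≉ a
  ≉-sym a≉b b≈a = a≉b (≈-sym b≈a)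

  ≈-setoid : Setoid 0ℓ 0ℓ
  ≈-setoid = record
    { _≈_           = _≈_
    ; isEquivalence = record { refl = ≈-refl ; sym = ≈-sym ; trans = ≈-trans }
    }

  module ≈-Reasoning = SetoidReasoning ≈-setoid

  _≈?_ : ∀ a b → Dec (a ≈ b)
  a ≈? b = Dec.map′ mk≈ _≈_.divides-difference (+ p ∣? a - b)

  ∣⇒≈0 : ∀ {a} → + p ∣ a → a ≈ 0ℤ
  ∣⇒≈0 {a} p∣a = mk≈ (∣-≡ (ℤ.+-identityʳ a) p∣a)

  ≈0⇒∣ : ∀ {a} → a ≈ 0ℤ → + p ∣ a
  ≈0⇒∣ {a} (mk≈ p∣a-0) = ∣-≡ (sym (ℤ.+-identityʳ a)) p∣a-0

  ≉⇒-≉0 : ∀ {a b} → a ≉ b → a - b ≉ 0ℤ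
  ≉⇒-≉0 a≉b = a≉b ∘ mk≈ ∘ ≈0⇒∣

  +-cong : ∀ {a b c d} → a ≈ b → c ≈ d → a + c ≈ b + d
  +-cong {a} {b} {c} {d} (mk≈ p∣a-b) (mk≈ p∣c-d) = mk≈ (∣-≡ (regroup a b c d) (∣m∣n⇒∣m+n p∣a-b p∣c-d))
    where regroup : ∀ a b c d → (a + c) - (b + d) ≡ (a - b) + (c - d)
          regroup = solve-∀

  -‿cong : ∀ {a b} → a ≈ b → - a ≈ - b
  -‿cong {a} {b} (mk≈ p∣a-b) = mk≈ (∣-≡ (negate a b) (∣m⇒∣-m p∣a-b))
    where negate : ∀ a b → (- a) - (- b) ≡ - (a - b)
          negate = solve-∀

  -‿cong₂ : ∀ {a b c d} → a ≈ b → c ≈ d → a - c ≈ b - d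
  -‿cong₂ a≈b c≈d = +-cong a≈b (-‿cong c≈d)

  *-cong : ∀ {a b c d} → a ≈ b → c ≈ d → a * c ≈ b * d
  *-cong {a} {b} {c} {d} (mk≈ p∣a-b) (mk≈ p∣c-d) =
    mk≈ (∣-≡ (expand a b c d) (∣m∣n⇒∣m+n (∣n⇒∣m*n a p∣c-d) (∣n⇒∣m*n d p∣a-b)))
    where expand : ∀ a b c d → (a * c) - (b * d) ≡ a * (c - d) + d * (a - b)
          expand = solve-∀

  *-congˡ : ∀ a {c d} → c ≈ d → a * c ≈ a * d
  *-congˡ a = *-cong (≈-refl {a})

  *-congʳ : ∀ c {a b} → a ≈ b → a * c ≈ b * c
  *-congʳ c a≈b = *-cong a≈b (≈-refl {c})

  *≉0⇒≉0ˡ : ∀ {a} b → a * b ≉ 0ℤ → a ≉ 0ℤ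
  *≉0⇒≉0ˡ b ab≉0 a≈0 = ab≉0 (≈-trans (*-congʳ b a≈0) (≈-reflexive (ℤ.*-zeroˡ b)))

  *≉0⇒≉0ʳ : ∀ a {b} → a * b ≉ 0ℤ → b ≉ 0ℤ
  *≉0⇒≉0ʳ a ab≉0 b≈0 = ab≉0 (≈-trans (*-congˡ a b≈0) (≈-reflexive (ℤ.*-zeroʳ a)))

  private variable A : Set

  ∑-congᴬ : ∀ {xs : List A} {f g : A → ℤ} → All (λ x → f x ≈ g x) xs → ∑ xs f ≈ ∑ xs g
  ∑-congᴬ []           = ≈-refl
  ∑-congᴬ (fx≈gx ∷ eq) = +-cong fx≈gx (∑-congᴬ eq)

  ∑≉0⇒∃≉0 : ∀ (xs : List A) f → ∑ xs f ≉ 0ℤ → ∃[ x ] x ∈ xs × f x ≉ 0ℤ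
  ∑≉0⇒∃≉0 []       f ∑≉0 = contradiction ≈-refl ∑≉0
  ∑≉0⇒∃≉0 (x ∷ xs) f ∑≉0 with f x ≈? 0ℤ
  ... | no fx≉0  = x , here refl , fx≉0
  ... | yes fx≈0 =
    let y , y∈xs , fy≉0 = ∑≉0⇒∃≉0 xs f (λ ∑≈0 → ∑≉0 (+-cong fx≈0 ∑≈0)) in
    y , there y∈xs , fy≉0

  ∏≉0⇒≉0 : ∀ {xs : List A} f {x} → ∏ xs f ≉ 0ℤ → x ∈ xs → f x ≉ 0ℤ
  ∏≉0⇒≉0 {xs = x ∷ xs} f ∏≉0 (here refl)  = *≉0⇒≉0ˡ (∏ xs f) ∏≉0
  ∏≉0⇒≉0 {xs = y ∷ xs} f ∏≉0 (there x∈xs) = ∏≉0⇒≉0 f (*≉0⇒≉0ʳ (f y) ∏≉0) x∈xs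

module Inverse {p : ℕ} (p-prime : Prime p) where

  open import Data.Nat as ℕ using (suc)
  import Data.Nat.Divisibility as ℕ
  open import Data.Nat.Coprimality using (Coprime; coprime-Bézout)
  open import Data.Nat.GCD using (module Bézout)
  open import Data.Nat.Primality using (prime⇒irreducible)
  open import Data.Integer using (ℤ; +_; -_; -[1+_]; _+_; _-_; _*_; 0ℤ; 1ℤ)
  import Data.Integer.Properties as ℤ
  open import Data.Integer.Divisibility.Signed using (divides; ∣ᵤ⇒∣)
  open import Data.Integer.Tactic.RingSolver using (solve-∀)
  open import Data.Product using (∃-syntax; _,_; proj₁; proj₂)
  open import Data.Sum using (inj₁; inj₂)
  open import Function using (_∘_)
  open import Relation.Binary.PropositionalEquality using (_≡_; refl; cong; module ≡-Reasoning)
  open import Relation.Nullary using (¬_; yes; no; contradiction)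
  open Congruence p

  private
    coprime : ∀ {n} → ¬ p ℕ.∣ n → Coprime p n
    coprime p∤n (d∣p , d∣n) with prime⇒irreducible p-prime d∣p
    ... | inj₁ d≡1  = d≡1
    ... | inj₂ refl = contradiction d∣n p∤n

    pos-bézout : ∀ a b c d → 1 ℕ.+ a ℕ.* b ≡ c ℕ.* d → 1ℤ + + a * + b ≡ + c * + d
    pos-bézout a b c d eq = begin
      1ℤ + + a * + b    ≡⟨ cong (_+_ 1ℤ) (ℤ.pos-* a b) ⟨
      + (1 ℕ.+ a ℕ.* b) ≡⟨ cong +_ eq ⟩
      + (c ℕ.* d)       ≡⟨ ℤ.pos-* c d ⟩
      + c * + d         ∎
      where open ≡-Reasoning

    inverseℕ : ∀ {n} → Coprime p n → ∃[ b ] + n * b ≈ 1ℤ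
    inverseℕ {n} p⊥n with coprime-Bézout p⊥n
    ... | Bézout.+- x y 1+yn≡xp = - + y , mk≈ (divides (- + x) (begin
      + n * - + y - 1ℤ   ≡⟨ rearrange (+ n) (+ y) ⟩
      - (1ℤ + + y * + n) ≡⟨ cong -_ (pos-bézout y n x p 1+yn≡xp) ⟩
      - (+ x * + p)      ≡⟨ ℤ.neg-distribˡ-* (+ x) (+ p) ⟩
      - + x * + p        ∎))
      where open ≡-Reasoning
            rearrange : ∀ n y → n * - y - 1ℤ ≡ - (1ℤ + y * n)
            rearrange = solve-∀
    ... | Bézout.-+ x y 1+xp≡yn = + y , mk≈ (divides (+ x) (begin
      + n * + y - 1ℤ        ≡⟨ cong (_- 1ℤ) (ℤ.*-comm (+ n) (+ y)) ⟩
      + y * + n - 1ℤ        ≡⟨ cong (_- 1ℤ) (pos-bézout x p y n 1+xp≡yn) ⟨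
      (1ℤ + + x * + p) - 1ℤ ≡⟨ cancel (+ x * + p) ⟩
      + x * + p             ∎))
      where open ≡-Reasoning
            cancel : ∀ z → (1ℤ + z) - 1ℤ ≡ z
            cancel = solve-∀

  inverse : ∀ {a} → a ≉ 0ℤ → ∃[ b ] a * b ≈ 1ℤ
  inverse {a@(+ n)}      a≉0 = inverseℕ (coprime (a≉0 ∘ ∣⇒≈0 ∘ ∣ᵤ⇒∣ {+ p} {a}))
  inverse {a@(-[1+ n ])} a≉0 =
    let b , nb≈1 = inverseℕ (coprime (a≉0 ∘ ∣⇒≈0 ∘ ∣ᵤ⇒∣ {+ p} {a})) in
    - b , ≈-trans (≈-reflexive (neg*neg (+ suc n) b)) nb≈1
    where neg*neg : ∀ m b → - m * - b ≡ m * b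
          neg*neg = solve-∀

  -- junk value 0 on multiples of p
  inv : ℤ → ℤ
  inv a with a ≈? 0ℤ
  ... | yes _  = 0ℤ
  ... | no a≉0 = proj₁ (inverse a≉0)

  *-inverseʳ : ∀ {a} → a ≉ 0ℤ → a * inv a ≈ 1ℤ
  *-inverseʳ {a} a≉0 with a ≈? 0ℤ
  ... | yes a≈0  = contradiction a≈0 a≉0
  ... | no  a≉0′ = proj₂ (inverse a≉0′)

  *-cancelˡ : ∀ {a x y} → a ≉ 0ℤ → a * x ≈ a * y → x ≈ y
  *-cancelˡ {a} {x} {y} a≉0 ax≈ay = begin
    x               ≡⟨ ℤ.*-identityˡ x ⟨
    1ℤ * x          ≈⟨ *-congʳ x (*-inverseʳ a≉0) ⟨
    (a * inv a) * x ≡⟨ reassoc a (inv a) x ⟩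
    inv a * (a * x) ≈⟨ *-congˡ (inv a) ax≈ay ⟩
    inv a * (a * y) ≡⟨ reassoc a (inv a) y ⟨
    (a * inv a) * y ≈⟨ *-congʳ y (*-inverseʳ a≉0) ⟩
    1ℤ * y          ≡⟨ ℤ.*-identityˡ y ⟩
    y               ∎
    where open ≈-Reasoning
          reassoc : ∀ a i x → (a * i) * x ≡ i * (a * x)
          reassoc = solve-∀

module Polynomials where

  open import Data.Nat as ℕ using (zero; suc; _≤_; _<_)
  import Data.Nat.Properties as ℕ
  open import Data.Integer using (ℤ; -_; _+_; _*_; _^_; 0ℤ; 1ℤ)
  import Data.Integer.Properties as ℤ
  open import Data.Fin using (Fin; zero; suc)
  open import Data.Vec as Vec using (Vec; []; _∷_; replicate; zipWith; updateAt; lookup)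
  open import Data.Vec.Properties using (≡-dec)
  open import Data.Vec.Functional using (Vector; head; tail)
  open import Data.List using ([]; _∷_; _++_; map)
  open import Data.List.Relation.Unary.All as All using (All; []; _∷_)
  import Data.List.Relation.Unary.All.Properties as All
  open import Data.Product using (∃-syntax; _×_; _,_; proj₂)
  open import Function using (_∘_)
  open import Relation.Binary.Definitions using (tri<; tri≈; tri>)
  open import Relation.Binary.PropositionalEquality using (_≡_; _≢_; refl; sym; trans; cong; cong₂; subst; module ≡-Reasoning)
  open import Relation.Nullary using (yes; no; contradiction)
  open import Algebra.Properties.CommutativeSemigroup ℕ.+-commutativeSemigroup using () renaming (interchange to +-interchange)
  open import Algebra.Properties.CommutativeSemigroup ℤ.*-commutativeSemigroup using () renaming (interchange to *-interchange)
  open Sums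

  private variable
    s : ℕ
    P Q : ℕ → Set

  monomial : Vec ℕ s → Vector ℤ s → ℤ
  monomial []      t = 1ℤ
  monomial (k ∷ e) t = head t ^ k * monomial e (tail t)

  eval : Poly s → Vector ℤ s → ℤ
  eval q t = ∑ q (λ (c , e) → c * monomial e t)

  constant : ℤ → Poly s
  constant {s} c = (c , replicate s 0) ∷ []

  monomial-zipWith : ∀ (e e′ : Vec ℕ s) t → monomial (zipWith ℕ._+_ e e′) t ≡ monomial e t * monomial e′ t
  monomial-zipWith []      []        t = refl
  monomial-zipWith (k ∷ e) (k′ ∷ e′) t = begin
    x ^ (k ℕ.+ k′) * monomial (zipWith ℕ._+_ e e′) (tail t)
      ≡⟨ cong₂ _*_ (ℤ.^-distribˡ-+-* x k k′) (monomial-zipWith e e′ (tail t)) ⟩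
    (x ^ k * x ^ k′) * (monomial e (tail t) * monomial e′ (tail t))
      ≡⟨ *-interchange (x ^ k) (x ^ k′) (monomial e (tail t)) (monomial e′ (tail t)) ⟩
    (x ^ k * monomial e (tail t)) * (x ^ k′ * monomial e′ (tail t)) ∎
    where open ≡-Reasoning
          x = head t

  monomial-zero : ∀ (t : Vector ℤ s) → monomial (replicate s 0) t ≡ 1ℤ
  monomial-zero {zero}  t = refl
  monomial-zero {suc s} t = trans (ℤ.*-identityˡ _) (monomial-zero (tail t))

  monomial-var : ∀ (i : Fin s) t → monomial (updateAt (replicate s 0) i (λ _ → 1)) t ≡ t i
  monomial-var {suc s} zero    t = trans (cong (head t * 1ℤ *_) (monomial-zero (tail t)))
                                         (trans (ℤ.*-identityʳ _) (ℤ.*-identityʳ _))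
  monomial-var {suc s} (suc i) t = trans (ℤ.*-identityˡ _) (monomial-var i (tail t))

  eval-⊕ : ∀ (q r : Poly s) t → eval (q ⊕ r) t ≡ eval q t + eval r t
  eval-⊕ q r t = ∑-++ q r _

  eval-⊖ : ∀ (q : Poly s) t → eval (⊖ q) t ≡ - eval q t
  eval-⊖ []            t = refl
  eval-⊖ ((c , e) ∷ q) t = trans (cong₂ _+_ (sym (ℤ.neg-distribˡ-* c (monomial e t))) (eval-⊖ q t))
                                 (sym (ℤ.neg-distrib-+ (c * monomial e t) (eval q t)))

  eval-⊗ : ∀ (q r : Poly s) t → eval (q ⊗ r) t ≡ eval q t * eval r t
  eval-⊗ []            r t = refl
  eval-⊗ ((c , e) ∷ q) r t = begin
    eval (map mul r ++ (q ⊗ r)) t                   ≡⟨ eval-⊕ (map mul r) (q ⊗ r) t ⟩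
    eval (map mul r) t + eval (q ⊗ r) t             ≡⟨ cong₂ _+_ leading (eval-⊗ q r t) ⟩
    c * monomial e t * eval r t + eval q t * eval r t ≡⟨ ℤ.*-distribʳ-+ (eval r t) (c * monomial e t) (eval q t) ⟨
    (c * monomial e t + eval q t) * eval r t          ∎
    where
      open ≡-Reasoning
      mul : ℤ × Vec ℕ _ → ℤ × Vec ℕ _
      mul (d , e′) = (c * d , zipWith ℕ._+_ e e′)
      leading : eval (map mul r) t ≡ c * monomial e t * eval r t
      leading = begin
        eval (map mul r) t
          ≡⟨ ∑-map mul r _ ⟩
        ∑ r (λ (d , e′) → c * d * monomial (zipWith ℕ._+_ e e′) t)
          ≡⟨ ∑-cong r (λ (d , e′) → trans (cong (c * d *_) (monomial-zipWith e e′ t))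
                                          (*-interchange c d (monomial e t) (monomial e′ t))) ⟩
        ∑ r (λ (d , e′) → c * monomial e t * (d * monomial e′ t))
          ≡⟨ ∑-*ˡ r (c * monomial e t) (λ (d , e′) → d * monomial e′ t) ⟩
        c * monomial e t * eval r t ∎

  eval-constant : ∀ c (t : Vector ℤ s) → eval (constant c) t ≡ c
  eval-constant c t = trans (ℤ.+-identityʳ _) (trans (cong (c *_) (monomial-zero t)) (ℤ.*-identityʳ c))

  eval-var : ∀ (i : Fin s) t → eval (var i) t ≡ t i
  eval-var i t = trans (ℤ.+-identityʳ _) (trans (ℤ.*-identityˡ _) (monomial-var i t))

  deg : Vec ℕ s → ℕ
  deg = Vec.sum

  record HasDegree (P : ℕ → Set) (term : ℤ × Vec ℕ s) : Set where
    constructor hasDegree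
    field degree : P (deg (proj₂ term))

  AllDegrees : (ℕ → Set) → Poly s → Set
  AllDegrees P = All (HasDegree P)

  deg-zipWith : ∀ (e e′ : Vec ℕ s) → deg (zipWith ℕ._+_ e e′) ≡ deg e ℕ.+ deg e′
  deg-zipWith []      []        = refl
  deg-zipWith (k ∷ e) (k′ ∷ e′) =
    trans (cong ((k ℕ.+ k′) ℕ.+_) (deg-zipWith e e′)) (+-interchange k k′ (deg e) (deg e′))

  deg-zero : ∀ s → deg (replicate s 0) ≡ 0
  deg-zero zero    = refl
  deg-zero (suc s) = deg-zero s

  deg-var : ∀ (i : Fin s) → deg (updateAt (replicate s 0) i (λ _ → 1)) ≡ 1
  deg-var {suc s} zero    = cong suc (deg-zero s)
  deg-var {suc s} (suc i) = deg-var i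

  deg≤∧≢⇒∃< : ∀ (e f : Vec ℕ s) → deg e ≤ deg f → e ≢ f → ∃[ i ] lookup e i < lookup f i
  deg≤∧≢⇒∃< []      []      _  e≢f = contradiction refl e≢f
  deg≤∧≢⇒∃< (k ∷ e) (l ∷ f) le e≢f with ℕ.<-cmp k l
  ... | tri< k<l _ _  = zero , k<l
  ... | tri≈ _ refl _ =
    let i , ei<fi = deg≤∧≢⇒∃< e f (ℕ.+-cancelˡ-≤ k _ _ le) (e≢f ∘ cong (k ∷_)) in suc i , ei<fi
  ... | tri> _ _ l<k  =
    let i , ei<fi = deg≤∧≢⇒∃< e f (ℕ.<⇒≤ de<df) (ℕ.<⇒≢ de<df ∘ cong deg) in suc i , ei<fi
    where de<df : deg e < deg f
          de<df = ℕ.≰⇒> (λ df≤de → ℕ.<⇒≱ (ℕ.+-mono-<-≤ l<k df≤de) le)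

  AllDegrees-⊕ : ∀ {q r : Poly s} → AllDegrees P q → AllDegrees P r → AllDegrees P (q ⊕ r)
  AllDegrees-⊕ = All.++⁺

  AllDegrees-⊖ : ∀ {q : Poly s} → AllDegrees P q → AllDegrees P (⊖ q)
  AllDegrees-⊖ = All.map⁺ ∘ All.map (λ (hasDegree d) → hasDegree d)

  AllDegrees-weaken : (∀ {m} → P m → Q m) → ∀ {q : Poly s} → AllDegrees P q → AllDegrees Q q
  AllDegrees-weaken P⇒Q = All.map (λ (hasDegree d) → hasDegree (P⇒Q d))

  AllDegrees-⊗ : ∀ {P Q R : ℕ → Set} → (∀ {m n} → P m → Q n → R (m ℕ.+ n)) →
                 ∀ {q r : Poly s} → AllDegrees P q → AllDegrees Q r → AllDegrees R (q ⊗ r)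
  AllDegrees-⊗ PQ⇒R []                                          Qr = []
  AllDegrees-⊗ {Q = Q} {R} PQ⇒R {(c , e) ∷ q} (hasDegree Pe ∷ Pq) Qr =
    All.++⁺ (All.map⁺ (leading Qr)) (AllDegrees-⊗ PQ⇒R Pq Qr)
    where
      leading : ∀ {r} → AllDegrees Q r → All (λ (d , e′) → HasDegree R (c * d , zipWith ℕ._+_ e e′)) r
      leading = All.map (λ {(_ , e′)} (hasDegree Qe′) → hasDegree (subst R (sym (deg-zipWith e e′)) (PQ⇒R Pe Qe′)))

  AllDegrees-var : ∀ (i : Fin s) → AllDegrees (_≡ 1) (var i)
  AllDegrees-var i = hasDegree (deg-var i) ∷ []

  AllDegrees-constant : ∀ c → AllDegrees (_≡ 0) (constant {s} c)
  AllDegrees-constant {s} c = hasDegree (deg-zero s) ∷ []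

  coeff-vanishes : ∀ (f : Vec ℕ s) {q} → AllDegrees (_≢ deg f) q → coeff f q ≡ 0ℤ
  coeff-vanishes f {[]}          []                    = refl
  coeff-vanishes f {(c , e) ∷ q} (hasDegree e≢f ∷ q≢f) with ≡-dec ℕ._≟_ e f
  ... | yes refl = contradiction refl e≢f
  ... | no _     = coeff-vanishes f q≢f

  coeff≢0⇒deg : ∀ (f : Vec ℕ s) {q n} → coeff f q ≢ 0ℤ → AllDegrees (_≡ n) q → deg f ≡ n
  coeff≢0⇒deg f coeff≢0 q≡n with deg f ℕ.≟ _
  ... | yes f≡n = f≡n
  ... | no  f≢n = contradiction (coeff-vanishes f (AllDegrees-weaken (λ { refl e≡f → f≢n (sym e≡f) }) q≡n)) coeff≢0

module ShiftedDiscriminant where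

  open import Data.Nat as ℕ using (suc; _<_; s≤s)
  import Data.Nat.Properties as ℕ
  open import Data.Integer using (ℤ; -_; _+_; _-_; _*_; 1ℤ)
  import Data.Integer.Properties as ℤ
  open import Data.Integer.Tactic.RingSolver using (solve-∀)
  open import Data.Fin using (Fin)
  open import Data.Vec.Functional using (Vector)
  open import Data.List using (List; []; _∷_; length; foldr)
  open import Data.List.Relation.Unary.All using ([])
  open import Data.Product using (_×_; _,_)
  open import Relation.Binary.PropositionalEquality using (_≡_; refl; sym; trans; cong; cong₂; subst; module ≡-Reasoning)
  open Sums
  open Polynomials

  private variable s : ℕ

  diff : Fin s → Fin s → Poly s
  diff i j = var j ⊕ (⊖ var i)

  -- discPoly s is squaredDiffs (pairsLt s) by definition
  squaredDiffs : List (Fin s × Fin s) → Poly s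
  squaredDiffs = foldr (λ (i , j) D → (diff i j ⊗ diff i j) ⊗ D) one

  lowerTerms : Vector ℤ s → List (Fin s × Fin s) → Poly s
  lowerTerms γ []            = []
  lowerTerms γ ((i , j) ∷ L) =
    ((diff i j ⊗ diff i j) ⊗ lowerTerms γ L) ⊕ ((diff i j ⊗ constant (γ j - γ i)) ⊗ (squaredDiffs L ⊕ lowerTerms γ L))

  shiftedProduct : Vector ℤ s → List (Fin s × Fin s) → Vector ℤ s → ℤ
  shiftedProduct γ L t = ∏ L (λ (i , j) → (t j - t i) * (t j - t i + (γ j - γ i)))

  eval-diff : ∀ (i j : Fin s) t → eval (diff i j) t ≡ t j - t i
  eval-diff i j t = trans (eval-⊕ (var j) (⊖ var i) t)
                          (cong₂ _+_ (eval-var j t) (trans (eval-⊖ (var i) t) (cong -_ (eval-var i t))))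

  eval-shiftedProduct : ∀ γ (L : List (Fin s × Fin s)) t → eval (squaredDiffs L ⊕ lowerTerms γ L) t ≡ shiftedProduct γ L t
  eval-shiftedProduct γ []            t = trans (eval-⊕ one [] t) (trans (ℤ.+-identityʳ _) (eval-constant 1ℤ t))
  eval-shiftedProduct γ ((i , j) ∷ L) t = begin
    eval (D′ ⊕ E′) t                                ≡⟨ eval-⊕ D′ E′ t ⟩
    eval D′ t + eval E′ t                           ≡⟨ cong₂ _+_ eval-D′ eval-E′ ⟩
    (a * a) * d + ((a * a) * e + (a * g) * (d + e)) ≡⟨ factor a g d e ⟩
    a * (a + g) * (d + e)                           ≡⟨ cong (a * (a + g) *_) (eval-⊕ D E t) ⟨
    a * (a + g) * eval (D ⊕ E) t                    ≡⟨ cong (a * (a + g) *_) (eval-shiftedProduct γ L t) ⟩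
    shiftedProduct γ ((i , j) ∷ L) t                ∎
    where
      open ≡-Reasoning
      D = squaredDiffs L
      E = lowerTerms γ L
      D′ = squaredDiffs ((i , j) ∷ L)
      E′ = lowerTerms γ ((i , j) ∷ L)
      a = t j - t i
      g = γ j - γ i
      d = eval D t
      e = eval E t
      factor : ∀ a g d e → (a * a) * d + ((a * a) * e + (a * g) * (d + e)) ≡ a * (a + g) * (d + e)
      factor = solve-∀
      eval-diff² : eval (diff i j ⊗ diff i j) t ≡ a * a
      eval-diff² = trans (eval-⊗ (diff i j) (diff i j) t) (cong₂ _*_ (eval-diff i j t) (eval-diff i j t))
      eval-diff·g : eval (diff i j ⊗ constant g) t ≡ a * g
      eval-diff·g = trans (eval-⊗ (diff i j) (constant g) t) (cong₂ _*_ (eval-diff i j t) (eval-constant g t))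
      eval-D′ : eval D′ t ≡ (a * a) * d
      eval-D′ = trans (eval-⊗ (diff i j ⊗ diff i j) D t) (cong (_* d) eval-diff²)
      eval-E′ : eval E′ t ≡ (a * a) * e + (a * g) * (d + e)
      eval-E′ = trans (eval-⊕ ((diff i j ⊗ diff i j) ⊗ E) ((diff i j ⊗ constant g) ⊗ (D ⊕ E)) t)
        (cong₂ _+_ (trans (eval-⊗ (diff i j ⊗ diff i j) E t) (cong (_* e) eval-diff²))
                   (trans (eval-⊗ (diff i j ⊗ constant g) (D ⊕ E) t) (cong₂ _*_ eval-diff·g (eval-⊕ D E t))))

  AllDegrees-diff : ∀ (i j : Fin s) → AllDegrees (_≡ 1) (diff i j)
  AllDegrees-diff i j = AllDegrees-⊕ (AllDegrees-var j) (AllDegrees-⊖ (AllDegrees-var i))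

  AllDegrees-diff² : ∀ (i j : Fin s) → AllDegrees (_≡ 2) (diff i j ⊗ diff i j)
  AllDegrees-diff² i j = AllDegrees-⊗ (λ { refl refl → refl }) (AllDegrees-diff i j) (AllDegrees-diff i j)

  squaredDiffs-homogeneous : ∀ (L : List (Fin s × Fin s)) → AllDegrees (_≡ 2 ℕ.* length L) (squaredDiffs L)
  squaredDiffs-homogeneous []            = AllDegrees-constant 1ℤ
  squaredDiffs-homogeneous ((i , j) ∷ L) =
    AllDegrees-⊗ (λ { refl refl → sym (ℕ.*-suc 2 (length L)) }) (AllDegrees-diff² i j) (squaredDiffs-homogeneous L)

  lowerTerms-degree : ∀ γ (L : List (Fin s × Fin s)) → AllDegrees (_< 2 ℕ.* length L) (lowerTerms γ L)
  lowerTerms-degree γ []            = []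
  lowerTerms-degree γ ((i , j) ∷ L) = AllDegrees-⊕
    (AllDegrees-⊗ (λ { refl m<2n → bound (s≤s (s≤s m<2n)) }) (AllDegrees-diff² i j) (lowerTerms-degree γ L))
    (AllDegrees-⊗ (λ { refl m≤2n → bound (s≤s (s≤s m≤2n)) })
      (AllDegrees-⊗ {R = _≡ 1} (λ { refl refl → refl }) (AllDegrees-diff i j) (AllDegrees-constant (γ j - γ i)))
      (AllDegrees-⊕ (AllDegrees-weaken ℕ.≤-reflexive (squaredDiffs-homogeneous L))
                    (AllDegrees-weaken ℕ.<⇒≤ (lowerTerms-degree γ L))))
    where
      bound : ∀ {m} → m < 2 ℕ.+ 2 ℕ.* length L → m < 2 ℕ.* suc (length L)
      bound {m} = subst (m <_) (sym (ℕ.*-suc 2 (length L)))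

module Interpolation {p : ℕ} (p-prime : Prime p) where

  open import Data.Nat using (zero; suc; _≤_; _<_; z≤n; s≤s)
  import Data.Nat.Properties as ℕ
  open import Data.Integer using (ℤ; _+_; _-_; _*_; _^_; 0ℤ; 1ℤ)
  import Data.Integer.Properties as ℤ
  open import Data.Integer.Tactic.RingSolver using (solve-∀)
  open import Data.List using (List; []; _∷_; length)
  open import Data.List.Relation.Unary.All as All using (All; []; _∷_)
  open import Data.List.Relation.Unary.AllPairs using (AllPairs; []; _∷_)
  open import Relation.Binary.PropositionalEquality using (_≡_; refl; trans; cong; cong₂; module ≡-Reasoning)
  open import Relation.Nullary using (yes; no; contradiction)
  open import Algebra.Properties.CommutativeSemigroup ℤ.+-commutativeSemigroup using () renaming (x∙yz≈y∙xz to +-exchange)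
  open import Algebra.Properties.CommutativeSemigroup ℤ.*-commutativeSemigroup using () renaming (x∙yz≈y∙xz to *-exchange)
  open Sums
  open Congruence p
  open Inverse p-prime

  δ : ℕ → ℕ → ℤ
  δ zero    zero    = 1ℤ
  δ zero    (suc n) = 0ℤ
  δ (suc k) zero    = 0ℤ
  δ (suc k) (suc n) = δ k n

  δ-diag : ∀ n → δ n n ≡ 1ℤ
  δ-diag zero    = refl
  δ-diag (suc n) = δ-diag n

  δ-< : ∀ {k n} → k < n → δ k n ≡ 0ℤ
  δ-< {zero}  {suc n} _         = refl
  δ-< {suc k} {suc n} (s≤s k<n) = δ-< k<n

  Distinct : List ℤ → Set
  Distinct = AllPairs _≉_

  -- (x - y)⁻¹, or 1 when y = x, so that weight T x is the product over y ∈ T other than x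
  invDiff : ℤ → ℤ → ℤ
  invDiff x y with x ℤ.≟ y
  ... | yes _ = 1ℤ
  ... | no _  = inv (x - y)

  weight : List ℤ → ℤ → ℤ
  weight []      x = 1ℤ
  weight (y ∷ T) x = invDiff x y * weight T x

  -- ∑_{x ∈ T} x^k / ∏_{y ≠ x} (x - y), the leading coefficient of the interpolant of x^k on T
  weightedPowerSum : List ℤ → ℕ → ℤ
  weightedPowerSum T k = ∑[ x ∈ T ] x ^ k * weight T x

  weight-self : ∀ x T → weight (x ∷ T) x ≡ weight T x
  weight-self x T with x ℤ.≟ x
  ... | yes _  = ℤ.*-identityˡ (weight T x)
  ... | no x≢x = contradiction refl x≢x

  *-weight-cons : ∀ {x y} T → x ≉ y → (x - y) * weight (y ∷ T) x ≈ weight T x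
  *-weight-cons {x} {y} T x≉y with x ℤ.≟ y
  ... | yes refl = contradiction ≈-refl x≉y
  ... | no _     = begin
    (x - y) * (inv (x - y) * weight T x) ≡⟨ ℤ.*-assoc (x - y) _ _ ⟨
    ((x - y) * inv (x - y)) * weight T x ≈⟨ *-congʳ (weight T x) (*-inverseʳ (≉⇒-≉0 x≉y)) ⟩
    1ℤ * weight T x                      ≡⟨ ℤ.*-identityˡ (weight T x) ⟩
    weight T x                           ∎
    where open ≈-Reasoning

  weightedPowerSum-swap : ∀ c d U k → weightedPowerSum (c ∷ d ∷ U) k ≡ weightedPowerSum (d ∷ c ∷ U) k
  weightedPowerSum-swap c d U k = begin
    c ^ k * weight (c ∷ d ∷ U) c + (d ^ k * weight (c ∷ d ∷ U) d + (∑[ x ∈ U ] x ^ k * weight (c ∷ d ∷ U) x))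
      ≡⟨ +-exchange (c ^ k * weight (c ∷ d ∷ U) c) (d ^ k * weight (c ∷ d ∷ U) d) _ ⟩
    d ^ k * weight (c ∷ d ∷ U) d + (c ^ k * weight (c ∷ d ∷ U) c + (∑[ x ∈ U ] x ^ k * weight (c ∷ d ∷ U) x))
      ≡⟨ ∑-cong (d ∷ c ∷ U) (λ x → cong (x ^ k *_) (*-exchange (invDiff x c) (invDiff x d) (weight U x))) ⟩
    weightedPowerSum (d ∷ c ∷ U) k ∎
    where open ≡-Reasoning

  weightedPowerSum-suc : ∀ {c U} k → All (c ≉_) U →
    weightedPowerSum (c ∷ U) (suc k) ≈ c * weightedPowerSum (c ∷ U) k + weightedPowerSum U k
  weightedPowerSum-suc {c} {U} k c≉U = begin
    ∑[ x ∈ c ∷ U ] x * x ^ k * W x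
      ≡⟨ ∑-cong (c ∷ U) (λ x → split c x (x ^ k) (W x)) ⟩
    ∑[ x ∈ c ∷ U ] (c * (x ^ k * W x) + (x - c) * (x ^ k * W x))
      ≡⟨ ∑-distrib-+ (c ∷ U) (λ x → c * (x ^ k * W x)) (λ x → (x - c) * (x ^ k * W x)) ⟩
    (∑[ x ∈ c ∷ U ] c * (x ^ k * W x)) + (∑[ x ∈ c ∷ U ] (x - c) * (x ^ k * W x))
      ≡⟨ cong₂ _+_ (∑-*ˡ (c ∷ U) c _) (cong (_+ (∑[ x ∈ U ] (x - c) * (x ^ k * W x))) (vanish (c ^ k * W c))) ⟩
    c * weightedPowerSum (c ∷ U) k + (0ℤ + (∑[ x ∈ U ] (x - c) * (x ^ k * W x)))
      ≈⟨ +-cong (≈-refl {c * weightedPowerSum (c ∷ U) k})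
                (+-cong (≈-refl {0ℤ}) (∑-congᴬ (All.map cancel c≉U))) ⟩
    c * weightedPowerSum (c ∷ U) k + (0ℤ + weightedPowerSum U k)
      ≡⟨ cong (_+_ (c * weightedPowerSum (c ∷ U) k)) (ℤ.+-identityˡ _) ⟩
    c * weightedPowerSum (c ∷ U) k + weightedPowerSum U k ∎
    where
      open ≈-Reasoning
      W = weight (c ∷ U)
      split : ∀ c x a w → x * a * w ≡ c * (a * w) + (x - c) * (a * w)
      split = solve-∀
      vanish : ∀ a → (c - c) * a ≡ 0ℤ
      vanish a = trans (cong (_* a) (ℤ.+-inverseʳ c)) (ℤ.*-zeroˡ a)
      cancel : ∀ {x} → c ≉ x → (x - c) * (x ^ k * W x) ≈ x ^ k * weight U x
      cancel {x} c≉x = ≈-trans (≈-reflexive (*-exchange (x - c) (x ^ k) (W x)))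
                               (*-congˡ (x ^ k) (*-weight-cons U (≉-sym c≉x)))

  -- expand weightedPowerSum (c ∷ d ∷ U) (suc k) by weightedPowerSum-suc, once with c and once with d in front
  weightedPowerSum-sub : ∀ {c d U} k → c ≉ d → All (c ≉_) U → All (d ≉_) U →
    (c - d) * weightedPowerSum (c ∷ d ∷ U) k ≈ weightedPowerSum (c ∷ U) k - weightedPowerSum (d ∷ U) k
  weightedPowerSum-sub {c} {d} {U} k c≉d c≉U d≉U = begin
    (c - d) * H
      ≡⟨ rearrange c d H hc hd ⟩
    ((c * H + hd) - (d * H + hc)) + (hc - hd)
      ≈⟨ +-cong (-‿cong₂ (≈-sym viaC) (≈-sym viaD)) (≈-refl {hc - hd}) ⟩
    (H⁺ - H⁺) + (hc - hd)
      ≡⟨ cong (_+ (hc - hd)) (ℤ.+-inverseʳ H⁺) ⟩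
    0ℤ + (hc - hd)
      ≡⟨ ℤ.+-identityˡ (hc - hd) ⟩
    hc - hd ∎
    where
      open ≈-Reasoning
      H = weightedPowerSum (c ∷ d ∷ U) k
      H⁺ = weightedPowerSum (c ∷ d ∷ U) (suc k)
      hc = weightedPowerSum (c ∷ U) k
      hd = weightedPowerSum (d ∷ U) k
      rearrange : ∀ c d H hc hd → (c - d) * H ≡ ((c * H + hd) - (d * H + hc)) + (hc - hd)
      rearrange = solve-∀
      viaC : H⁺ ≈ c * H + hd
      viaC = weightedPowerSum-suc k (c≉d ∷ c≉U)
      viaD : H⁺ ≈ d * H + hc
      viaD = begin
        H⁺                                       ≡⟨ weightedPowerSum-swap c d U (suc k) ⟩
        weightedPowerSum (d ∷ c ∷ U) (suc k)     ≈⟨ weightedPowerSum-suc k (≉-sym c≉d ∷ d≉U) ⟩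
        d * weightedPowerSum (d ∷ c ∷ U) k + hc  ≡⟨ cong (λ h → d * h + hc) (weightedPowerSum-swap c d U k) ⟨
        d * H + hc                               ∎

  weightedPowerSum≈δ : ∀ {T n} k → Distinct T → length T ≡ suc n → k ≤ n → weightedPowerSum T k ≈ δ k n
  weightedPowerSum≈δ {c ∷ []} zero _ refl z≤n =
    ≈-reflexive (trans (ℤ.+-identityʳ _) (trans (ℤ.*-identityˡ _) (weight-self c [])))
  weightedPowerSum≈δ {c ∷ d ∷ U} zero ((c≉d ∷ c≉U) ∷ d≉U ∷ D) refl _ =
    *-cancelˡ (≉⇒-≉0 c≉d) (begin
      (c - d) * weightedPowerSum (c ∷ d ∷ U) 0
        ≈⟨ weightedPowerSum-sub 0 c≉d c≉U d≉U ⟩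
      weightedPowerSum (c ∷ U) 0 - weightedPowerSum (d ∷ U) 0
        ≈⟨ -‿cong₂ (weightedPowerSum≈δ 0 (c≉U ∷ D) refl z≤n) (weightedPowerSum≈δ 0 (d≉U ∷ D) refl z≤n) ⟩
      δ 0 (length U) - δ 0 (length U)
        ≡⟨ ℤ.+-inverseʳ (δ 0 (length U)) ⟩
      0ℤ
        ≡⟨ ℤ.*-zeroʳ (c - d) ⟨
      (c - d) * 0ℤ ∎)
    where open ≈-Reasoning
  weightedPowerSum≈δ {c ∷ d ∷ U} (suc k) D@((c≉d ∷ c≉U) ∷ d≉U ∷ D′) refl (s≤s k≤n) = begin
    weightedPowerSum (c ∷ d ∷ U) (suc k)
      ≈⟨ weightedPowerSum-suc k (c≉d ∷ c≉U) ⟩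
    c * weightedPowerSum (c ∷ d ∷ U) k + weightedPowerSum (d ∷ U) k
      ≈⟨ +-cong (*-congˡ c (weightedPowerSum≈δ k D refl (ℕ.m≤n⇒m≤1+n k≤n)))
                (weightedPowerSum≈δ k (d≉U ∷ D′) refl k≤n) ⟩
    c * δ k (suc (length U)) + δ k (length U)
      ≡⟨ cong (λ z → c * z + δ k (length U)) (δ-< (s≤s k≤n)) ⟩
    c * 0ℤ + δ k (length U)
      ≡⟨ cong (_+ δ k (length U)) (ℤ.*-zeroʳ c) ⟩
    0ℤ + δ k (length U)
      ≡⟨ ℤ.+-identityˡ (δ k (length U)) ⟩
    δ k (length U) ∎
    where open ≈-Reasoning

module CoefficientFormula {p : ℕ} (p-prime : Prime p) where

  open import Data.Nat using (zero; suc; _≤_; _<_)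
  import Data.Nat.Properties as ℕ
  open import Data.Integer using (ℤ; _+_; _*_; _^_; 0ℤ; 1ℤ)
  import Data.Integer.Properties as ℤ
  open import Data.Integer.Tactic.RingSolver using (solve-∀)
  open import Data.Fin using (zero; suc)
  open import Data.Vec using (Vec; []; _∷_; lookup)
  open import Data.Vec.Properties using (≡-dec)
  open import Data.Vec.Functional as Vector using (Vector; head; tail)
  open import Data.List using (List; []; _∷_; length; map; concatMap)
  open import Data.List.Membership.Propositional using (_∈_; find)
  open import Data.List.Membership.Propositional.Properties using (∈-concatMap⁻; ∈-map⁻)
  open import Data.List.Relation.Unary.All using ([]; _∷_)
  open import Data.Product using (_×_; _,_)
  open import Function using (_∘_)
  open import Relation.Binary.PropositionalEquality using (_≡_; refl; trans; cong; cong₂; module ≡-Reasoning)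
  open import Relation.Nullary using (yes; no)
  open Sums
  open Polynomials
  open Congruence p
  open Interpolation p-prime

  private variable s : ℕ

  grid : Vector (List ℤ) s → List (Vector ℤ s)
  grid {zero}  T = Vector.[] ∷ []
  grid {suc s} T = concatMap (λ x → map (x Vector.∷_) (grid (tail T))) (head T)

  ∈-grid⁻ : ∀ {T : Vector (List ℤ) s} {t} → t ∈ grid T → ∀ i → t i ∈ T i
  ∈-grid⁻ {suc s} {T} t∈grid with find (∈-concatMap⁻ (λ x → map (x Vector.∷_) (grid (tail T))) {xs = head T} t∈grid)
  ... | x , x∈T₀ , t∈map with ∈-map⁻ (x Vector.∷_) t∈map
  ...   | t′ , t′∈grid , refl = λ { zero → x∈T₀ ; (suc i) → ∈-grid⁻ t′∈grid i }

  gridWeight : Vector (List ℤ) s → Vector ℤ s → ℤ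
  gridWeight {zero}  T t = 1ℤ
  gridWeight {suc s} T t = weight (head T) (head t) * gridWeight (tail T) (tail t)

  gridPowerSum : Vector (List ℤ) s → Vec ℕ s → ℤ
  gridPowerSum T []      = 1ℤ
  gridPowerSum T (k ∷ e) = weightedPowerSum (head T) k * gridPowerSum (tail T) e

  DistinctNodes : Vec ℕ s → Vector (List ℤ) s → Set
  DistinctNodes f T = ∀ i → Distinct (T i) × length (T i) ≡ suc (lookup f i)

  ∑-grid-monomial : ∀ (T : Vector (List ℤ) s) e →
                    ∑[ t ∈ grid T ] gridWeight T t * monomial e t ≡ gridPowerSum T e
  ∑-grid-monomial T []      = refl
  ∑-grid-monomial T (k ∷ e) = begin
    ∑[ t ∈ grid T ] gridWeight T t * monomial (k ∷ e) t
      ≡⟨ ∑-concatMap (λ x → map (x Vector.∷_) (grid (tail T))) (head T) _ ⟩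
    ∑[ x ∈ head T ] ∑ (map (x Vector.∷_) (grid (tail T))) (λ t → gridWeight T t * monomial (k ∷ e) t)
      ≡⟨ ∑-cong (head T) inner ⟩
    ∑[ x ∈ head T ] x ^ k * weight (head T) x * gridPowerSum (tail T) e
      ≡⟨ ∑-*ʳ (head T) (gridPowerSum (tail T) e) (λ x → x ^ k * weight (head T) x) ⟩
    gridPowerSum T (k ∷ e) ∎
    where
      open ≡-Reasoning
      regroup : ∀ w v a m → (w * v) * (a * m) ≡ a * w * (v * m)
      regroup = solve-∀
      inner : ∀ x → ∑ (map (x Vector.∷_) (grid (tail T))) (λ t → gridWeight T t * monomial (k ∷ e) t)
                  ≡ x ^ k * weight (head T) x * gridPowerSum (tail T) e
      inner x = begin
        ∑ (map (x Vector.∷_) (grid (tail T))) (λ t → gridWeight T t * monomial (k ∷ e) t)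
          ≡⟨ ∑-map (x Vector.∷_) (grid (tail T)) _ ⟩
        ∑[ t ∈ grid (tail T) ] (weight (head T) x * gridWeight (tail T) t) * (x ^ k * monomial e t)
          ≡⟨ ∑-cong (grid (tail T)) (λ t → regroup (weight (head T) x) (gridWeight (tail T) t) (x ^ k) (monomial e t)) ⟩
        ∑[ t ∈ grid (tail T) ] x ^ k * weight (head T) x * (gridWeight (tail T) t * monomial e t)
          ≡⟨ ∑-*ˡ (grid (tail T)) (x ^ k * weight (head T) x) (λ t → gridWeight (tail T) t * monomial e t) ⟩
        x ^ k * weight (head T) x * (∑[ t ∈ grid (tail T) ] gridWeight (tail T) t * monomial e t)
          ≡⟨ cong (x ^ k * weight (head T) x *_) (∑-grid-monomial (tail T) e) ⟩
        x ^ k * weight (head T) x * gridPowerSum (tail T) e ∎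

  ∑-grid-eval : ∀ (T : Vector (List ℤ) s) q →
                ∑[ t ∈ grid T ] gridWeight T t * eval q t ≡ ∑ q (λ (c , e) → c * gridPowerSum T e)
  ∑-grid-eval T []            = trans (∑-*ʳ (grid T) 0ℤ (gridWeight T)) (ℤ.*-zeroʳ (∑ (grid T) (gridWeight T)))
  ∑-grid-eval T ((c , e) ∷ q) = begin
    ∑[ t ∈ grid T ] gridWeight T t * (c * monomial e t + eval q t)
      ≡⟨ ∑-cong (grid T) (λ t → distrib (gridWeight T t) c (monomial e t) (eval q t)) ⟩
    ∑[ t ∈ grid T ] (c * (gridWeight T t * monomial e t) + gridWeight T t * eval q t)
      ≡⟨ ∑-distrib-+ (grid T) (λ t → c * (gridWeight T t * monomial e t)) (λ t → gridWeight T t * eval q t) ⟩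
    (∑[ t ∈ grid T ] c * (gridWeight T t * monomial e t)) + (∑[ t ∈ grid T ] gridWeight T t * eval q t)
      ≡⟨ cong₂ _+_ (trans (∑-*ˡ (grid T) c (λ t → gridWeight T t * monomial e t)) (cong (c *_) (∑-grid-monomial T e)))
                   (∑-grid-eval T q) ⟩
    c * gridPowerSum T e + ∑ q (λ (c , e) → c * gridPowerSum T e) ∎
    where
      open ≡-Reasoning
      distrib : ∀ w c m r → w * (c * m + r) ≡ c * (w * m) + w * r
      distrib = solve-∀

  gridPowerSum≈1 : ∀ {f} {T : Vector (List ℤ) s} → DistinctNodes f T → gridPowerSum T f ≈ 1ℤ
  gridPowerSum≈1 {f = []}    nodes = ≈-refl
  gridPowerSum≈1 {f = k ∷ f} nodes =
    let D , len = nodes zero in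
    *-cong (≈-trans (weightedPowerSum≈δ k D len ℕ.≤-refl) (≈-reflexive (δ-diag k)))
           (gridPowerSum≈1 {f = f} (nodes ∘ suc))

  gridPowerSum≈0 : ∀ {f e} {T : Vector (List ℤ) s} → DistinctNodes f T →
                   ∀ i → lookup e i < lookup f i → gridPowerSum T e ≈ 0ℤ
  gridPowerSum≈0 {f = l ∷ f} {k ∷ e} {T} nodes zero k<l =
    let D , len = nodes zero in
    ≈-trans (*-congʳ (gridPowerSum (tail T) e)
                     (≈-trans (weightedPowerSum≈δ k D len (ℕ.<⇒≤ k<l)) (≈-reflexive (δ-< k<l))))
            (≈-reflexive (ℤ.*-zeroˡ (gridPowerSum (tail T) e)))
  gridPowerSum≈0 {f = l ∷ f} {k ∷ e} {T} nodes (suc i) ei<fi =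
    ≈-trans (*-congˡ (weightedPowerSum (head T) k) (gridPowerSum≈0 {f = f} {e} (nodes ∘ suc) i ei<fi))
            (≈-reflexive (ℤ.*-zeroʳ (weightedPowerSum (head T) k)))

  coefficientFormula : ∀ {f} {T : Vector (List ℤ) s} → DistinctNodes f T → ∀ q → AllDegrees (_≤ deg f) q →
                       ∑[ t ∈ grid T ] gridWeight T t * eval q t ≈ coeff f q
  coefficientFormula {f = f} {T} nodes q q≤f = ≈-trans (≈-reflexive (∑-grid-eval T q)) (termwise q q≤f)
    where
      termwise : ∀ q → AllDegrees (_≤ deg f) q → ∑ q (λ (c , e) → c * gridPowerSum T e) ≈ coeff f q
      termwise []            []            = ≈-refl
      termwise ((c , e) ∷ q) (hasDegree e≤f ∷ q≤f) with ≡-dec ℕ._≟_ e f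
      ... | yes refl = +-cong (≈-trans (*-congˡ c (gridPowerSum≈1 {f = f} nodes)) (≈-reflexive (ℤ.*-identityʳ c)))
                              (termwise q q≤f)
      ... | no e≢f   =
        let i , ei<fi = deg≤∧≢⇒∃< e f e≤f e≢f in
        ≈-trans (+-cong (≈-trans (*-congˡ c (gridPowerSum≈0 {f = f} {e} nodes i ei<fi)) (≈-reflexive (ℤ.*-zeroʳ c)))
                        (termwise q q≤f))
                (≈-reflexive (ℤ.+-identityˡ (coeff f q)))

module Nonvanishing {p : ℕ} (p-prime : Prime p) where

  open import Data.Nat as ℕ using (_<_)
  import Data.Nat.Properties as ℕ
  open import Data.Integer using (ℤ; _+_; _*_; 0ℤ)
  import Data.Integer.Properties as ℤ
  open import Data.Vec using (Vec)
  open import Data.List using (length)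
  open import Data.List.Membership.Propositional using (_∈_)
  open import Data.Product using (∃-syntax; _×_; _,_)
  open import Function using (_∘_)
  open import Relation.Binary.PropositionalEquality using (_≡_; sym; trans; cong; subst)
  open Sums
  open Polynomials
  open ShiftedDiscriminant
  open Congruence p
  open CoefficientFormula p-prime

  -- of the two parts of the shifted product only the top-degree one, discPoly s, has a monomial of degree deg f
  ∑-weighted-shiftedProduct : ∀ {s} (f : Vec ℕ s) {T} γ → DistinctNodes f T → deg f ≡ 2 ℕ.* length (pairsLt s) →
    ∑[ t ∈ grid T ] gridWeight T t * shiftedProduct γ (pairsLt s) t ≈ coeff f (discPoly s)
  ∑-weighted-shiftedProduct {s} f {T} γ nodes deg-f = begin
    ∑[ t ∈ grid T ] W t * shiftedProduct γ L t
      ≡⟨ ∑-cong (grid T) (λ t → cong (W t *_) (trans (sym (eval-shiftedProduct γ L t)) (eval-⊕ D E t))) ⟩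
    ∑[ t ∈ grid T ] W t * (eval D t + eval E t)
      ≡⟨ ∑-cong (grid T) (λ t → ℤ.*-distribˡ-+ (W t) (eval D t) (eval E t)) ⟩
    ∑[ t ∈ grid T ] (W t * eval D t + W t * eval E t)
      ≡⟨ ∑-distrib-+ (grid T) (λ t → W t * eval D t) (λ t → W t * eval E t) ⟩
    (∑[ t ∈ grid T ] W t * eval D t) + (∑[ t ∈ grid T ] W t * eval E t)
      ≈⟨ +-cong (coefficientFormula nodes D (AllDegrees-weaken (ℕ.≤-reflexive ∘ D-deg) (squaredDiffs-homogeneous L)))
                (coefficientFormula nodes E (AllDegrees-weaken (ℕ.<⇒≤ ∘ E-deg) (lowerTerms-degree γ L))) ⟩
    coeff f D + coeff f E
      ≡⟨ cong (_+_ (coeff f D)) (coeff-vanishes f (AllDegrees-weaken (ℕ.<⇒≢ ∘ E-deg) (lowerTerms-degree γ L))) ⟩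
    coeff f D + 0ℤ
      ≡⟨ ℤ.+-identityʳ (coeff f D) ⟩
    coeff f D ∎
    where
      open ≈-Reasoning
      L = pairsLt s
      D = squaredDiffs L
      E = lowerTerms γ L
      W = gridWeight T
      D-deg : ∀ {m} → m ≡ 2 ℕ.* length L → m ≡ deg f
      D-deg m≡2n = trans m≡2n (sym deg-f)
      E-deg : ∀ {m} → m < 2 ℕ.* length L → m < deg f
      E-deg = subst (_ <_) (sym deg-f)

  shiftedProduct-nonvanishing : ∀ {s} (f : Vec ℕ s) {T} γ → DistinctNodes f T → coeff f (discPoly s) ≉ 0ℤ →
    ∃[ t ] (∀ i → t i ∈ T i) × shiftedProduct γ (pairsLt s) t ≉ 0ℤ
  shiftedProduct-nonvanishing {s} f {T} γ nodes coeff≉0 =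
    let deg-f = coeff≢0⇒deg f (coeff≉0 ∘ ≈-reflexive) (squaredDiffs-homogeneous (pairsLt s))
        ∑≈coeff = ∑-weighted-shiftedProduct f γ nodes deg-f
        t , t∈grid , Wt*P≉0 = ∑≉0⇒∃≉0 (grid T) _ (coeff≉0 ∘ ≈-trans (≈-sym ∑≈coeff))
    in t , ∈-grid⁻ t∈grid , *≉0⇒≉0ʳ (gridWeight T t) Wt*P≉0

module Pigeonhole where

  open import Data.Nat as ℕ using (zero; suc; _<_)
  import Data.Nat.Properties as ℕ
  open import Data.List using ([]; _∷_; length; filter)
  open import Data.List.Relation.Unary.All as All using (All; []; _∷_)
  import Data.List.Relation.Unary.All.Properties as All
  open import Data.List.Relation.Binary.Sublist.Propositional.Properties using (filter⁺; filter-⊆; length-mono-≤)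
  open import Data.Product using (∃-syntax; _,_)
  open import Function using (id)
  open import Level using (0ℓ)
  open import Relation.Binary.PropositionalEquality using (_≡_; refl; trans; cong)
  open import Relation.Nullary using (yes; no)
  open import Relation.Unary using (Pred; Decidable)
  open import Relation.Unary.Properties using (∁?)

  private variable A : Set

  length-filter+∁ : ∀ {P : Pred A 0ℓ} (P? : Decidable P) xs →
                    length (filter P? xs) ℕ.+ length (filter (∁? P?) xs) ≡ length xs
  length-filter+∁ P? []       = refl
  length-filter+∁ P? (x ∷ xs) with P? x
  ... | yes _ = cong suc (length-filter+∁ P? xs)
  ... | no _  = trans (ℕ.+-suc _ _) (cong suc (length-filter+∁ P? xs))

  pigeonhole : ∀ (c : A → ℕ) m {f} xs → All (λ x → c x < m) xs → m ℕ.* f < length xs →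
               ∃[ k ] f < length (filter (λ x → c x ℕ.≟ k) xs)
  pigeonhole c zero    []       []           ()
  pigeonhole c zero    (x ∷ xs) (() ∷ _)     _
  pigeonhole c (suc m) {f} xs c<1+m m*f<len with f ℕ.<? length (filter (λ x → c x ℕ.≟ m) xs)
  ... | yes f<count = m , f<count
  ... | no  f≮count =
    let k , f<count′ = pigeonhole c m rest c<m m*f<rest
        on-k? = λ x → c x ℕ.≟ k
    in k , ℕ.<-≤-trans f<count′ (length-mono-≤ (filter⁺ on-k? on-k? (λ { refl → id }) (filter-⊆ (∁? on-m?) xs)))
    where
      on-m? = λ x → c x ℕ.≟ m
      rest = filter (∁? on-m?) xs
      c<m : All (λ x → c x < m) rest
      c<m = All.zipWith (λ (c<1+m , c≢m) → ℕ.≤∧≢⇒< (ℕ.≤-pred c<1+m) c≢m)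
                        (All.filter⁺ (∁? on-m?) c<1+m , All.all-filter (∁? on-m?) xs)
      m*f<rest : m ℕ.* f < length rest
      m*f<rest = ℕ.+-cancelˡ-< f _ _ (begin-strict
        f ℕ.+ m ℕ.* f                       <⟨ m*f<len ⟩
        length xs                           ≡⟨ length-filter+∁ on-m? xs ⟨
        length (filter on-m? xs) ℕ.+ length rest ≤⟨ ℕ.+-monoˡ-≤ (length rest) (ℕ.≮⇒≥ f≮count) ⟩
        f ℕ.+ length rest                   ∎)
        where open ℕ.≤-Reasoning


module Diagonals {p : ℕ} (p-prime : Prime p) where

  open import Data.Nat as ℕ using (zero; suc; _<_; NonZero)
  import Data.Nat.Properties as ℕ
  import Data.Nat.Divisibility as ℕ
  open import Data.Nat.Primality using (prime⇒nonZero)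
  open import Data.Integer using (ℤ; +_; _+_; _-_; _*_; 0ℤ; ∣_∣)
  import Data.Integer.Properties as ℤ
  open import Data.Integer.DivMod using (_%ℕ_; _/ℕ_; a≡a%ℕn+[a/ℕn]*n; n%ℕd<d)
  open import Data.Integer.Divisibility.Signed using (divides; ∣⇒∣ᵤ)
  open import Data.Integer.Tactic.RingSolver using (solve-∀)
  open import Data.Fin using (Fin; toℕ)
  import Data.Fin.Properties as Fin
  open import Data.List using (List; []; _∷_; length; map; filter; take)
  import Data.List.Properties as List
  open import Data.List.Membership.Propositional using (_∈_)
  open import Data.List.Relation.Unary.All as All using (All; []; _∷_)
  import Data.List.Relation.Unary.All.Properties as All
  open import Data.List.Relation.Unary.AllPairs using (AllPairs; []; _∷_)
  import Data.List.Relation.Unary.AllPairs.Properties as AllPairs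
  open import Data.List.Relation.Unary.Unique.Propositional using (Unique)
  import Data.List.Relation.Unary.Unique.Propositional.Properties as Unique
  open import Data.Product using (_,_)
  open import Function using (id)
  open import Relation.Binary.PropositionalEquality using (_≡_; _≢_; refl; sym; trans; cong; module ≡-Reasoning)
  open import Relation.Nullary using (contradiction)
  open Congruence p
  open Interpolation p-prime using (Distinct)
  open Pigeonhole

  private
    instance
      p≢0 : NonZero p
      p≢0 = prime⇒nonZero p-prime

    ∣∧<⇒≡0 : ∀ {n} → p ℕ.∣ n → n < p → n ≡ 0
    ∣∧<⇒≡0 {zero}  _   _   = refl
    ∣∧<⇒≡0 {suc n} p∣n n<p = contradiction (ℕ.∣⇒≤ p∣n) (ℕ.<⇒≱ n<p)

  first second : Pair p → ℤ
  first  (a , _) = + toℕ a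
  second (_ , b) = + toℕ b

  -- the edges with diagonal k form the perfect matching {(a , a + k mod p)} of K_{p,p}
  diagonal : Pair p → ℕ
  diagonal x = (second x - first x) %ℕ p

  diagonal<p : ∀ x → diagonal x < p
  diagonal<p x = n%ℕd<d (second x - first x) p

  second≈first+diagonal : ∀ x → second x ≈ first x + + diagonal x
  second≈first+diagonal x = mk≈ (divides ((second x - first x) /ℕ p) (begin
    second x - (first x + + diagonal x)
      ≡⟨ regroup (second x) (first x) (+ diagonal x) ⟩
    (second x - first x) - + diagonal x
      ≡⟨ cong (_- + diagonal x) (a≡a%ℕn+[a/ℕn]*n (second x - first x) p) ⟩
    (+ diagonal x + (second x - first x) /ℕ p * + p) - + diagonal x
      ≡⟨ cancel (+ diagonal x) _ ⟩
    (second x - first x) /ℕ p * + p ∎))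
    where
      open ≡-Reasoning
      regroup : ∀ b a d → b - (a + d) ≡ (b - a) - d
      regroup = solve-∀
      cancel : ∀ d q → (d + q) - d ≡ q
      cancel = solve-∀

  toℕ-≈-injective : ∀ {i j : Fin p} → + toℕ i ≈ + toℕ j → i ≡ j
  toℕ-≈-injective {i} {j} (mk≈ p∣i-j) =
    Fin.toℕ-injective (ℤ.+-injective (ℤ.i-j≡0⇒i≡j _ _ (ℤ.∣i∣≡0⇒i≡0 (∣∧<⇒≡0 (∣⇒∣ᵤ p∣i-j) ∣i-j∣<p))))
    where
      ∣i-j∣<p : ∣ + toℕ i - + toℕ j ∣ < p
      ∣i-j∣<p = ℕ.≤-<-trans (ℕ.≤-reflexive (cong ∣_∣ (ℤ.m-n≡m⊖n (toℕ i) (toℕ j))))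
                  (ℕ.≤-<-trans (ℤ.∣m⊝n∣≤m⊔n (toℕ i) (toℕ j)) (ℕ.⊔-pres-<m (Fin.toℕ<n i) (Fin.toℕ<n j)))

  first-≉-on-diagonal : ∀ {x y} → x ≢ y → diagonal x ≡ diagonal y → first x ≉ first y
  first-≉-on-diagonal {a , b} {a′ , b′} x≢y same a≈a′ with toℕ-≈-injective a≈a′
  ... | refl = x≢y (cong (a ,_) (toℕ-≈-injective (begin
    + toℕ b                       ≈⟨ second≈first+diagonal (a , b) ⟩
    + toℕ a + + diagonal (a , b)  ≡⟨ cong (λ k → + toℕ a + + k) same ⟩
    + toℕ a + + diagonal (a , b′) ≈⟨ ≈-sym (second≈first+diagonal (a , b′)) ⟩
    + toℕ b′                      ∎)))
    where open ≈-Reasoning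

  distinct-firsts : ∀ {k S} → Unique S → All (λ x → diagonal x ≡ k) S → Distinct (map first S)
  distinct-firsts {k} unique on-k = AllPairs.map⁺ (go unique on-k)
    where
      go : ∀ {S} → Unique S → All (λ x → diagonal x ≡ k) S → AllPairs (λ x y → first x ≉ first y) S
      go []               []            = []
      go (x∉S ∷ unique) (x-on-k ∷ on-k) =
        All.zipWith (λ (x≢y , y-on-k) → first-≉-on-diagonal x≢y (trans x-on-k (sym y-on-k))) (x∉S , on-k)
          ∷ go unique on-k

  ≉0⇒Disjoint : ∀ x y → first y - first x ≉ 0ℤ → first y - first x + (+ diagonal y - + diagonal x) ≉ 0ℤ →
                Disjoint x y
  ≉0⇒Disjoint x@(a , b) y@(a′ , b′) Δfirst≉0 Δsecond≉0 = a≢a′ , b≢b′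
    where
      a≢a′ : a ≢ a′
      a≢a′ refl = Δfirst≉0 (≈-reflexive (ℤ.+-inverseʳ (first x)))
      regroup : ∀ a a′ d d′ → a′ - a + (d′ - d) ≡ (a′ + d′) - (a + d)
      regroup = solve-∀
      b≢b′ : b ≢ b′
      b≢b′ refl = Δsecond≉0 (begin
        first y - first x + (+ diagonal y - + diagonal x)
          ≡⟨ regroup (first x) (first y) (+ diagonal x) (+ diagonal y) ⟩
        (first y + + diagonal y) - (first x + + diagonal x)
          ≈⟨ -‿cong₂ (≈-sym (second≈first+diagonal y)) (≈-sym (second≈first+diagonal x)) ⟩
        second y - second x
          ≡⟨ ℤ.+-inverseʳ (second x) ⟩
        0ℤ ∎)
        where open ≈-Reasoning

  record DiagonalBlock (f : ℕ) (𝓕 : List (Pair p)) : Set where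
    field
      shift        : ℕ
      edges        : List (Pair p)
      length-edges : length edges ≡ suc f
      unique-edges : Unique edges
      edges⊆𝓕      : All (_∈ 𝓕) edges
      on-diagonal  : All (λ x → diagonal x ≡ shift) edges

  diagonalBlock : ∀ {f 𝓕} → Unique 𝓕 → p ℕ.* f < length 𝓕 → DiagonalBlock f 𝓕
  diagonalBlock {f} {𝓕} unique p*f<len =
    let k , f<count = pigeonhole diagonal p 𝓕 (All.tabulate (λ {x} _ → diagonal<p x)) p*f<len
        on-k? = λ x → diagonal x ℕ.≟ k
    in record
      { shift        = k
      ; edges        = take (suc f) (filter on-k? 𝓕)
      ; length-edges = trans (List.length-take (suc f) (filter on-k? 𝓕)) (ℕ.m≤n⇒m⊓n≡m f<count)
      ; unique-edges = Unique.take⁺ (suc f) (Unique.filter⁺ on-k? unique)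
      ; edges⊆𝓕      = All.take⁺ (suc f) (All.filter⁺ on-k? (All.tabulate id))
      ; on-diagonal  = All.take⁺ (suc f) (All.all-filter on-k? 𝓕)
      }

module Transversal {p : ℕ} (p-prime : Prime p) where

  open import Data.Integer using (ℤ; +_; _+_; _-_; _*_; 0ℤ)
  open import Data.Fin as Fin using (Fin; _<?_)
  import Data.Fin.Properties as Fin
  open import Data.Vec using (Vec; lookup)
  open import Data.List using (List; map; allFin; filter)
  import Data.List.Properties as List
  open import Data.List.Membership.Propositional using (_∈_; lose)
  open import Data.List.Membership.Propositional.Properties using (∈-concatMap⁺; ∈-map⁺; ∈-map⁻; ∈-filter⁺; ∈-allFin)
  import Data.List.Relation.Unary.All as All
  open import Data.Product using (Σ; ∃-syntax; _×_; _,_; proj₁; proj₂)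
  open import Function using (_∘_)
  open import Relation.Binary.Definitions using (tri<; tri≈; tri>)
  open import Relation.Binary.PropositionalEquality using (_≡_; _≢_; sym; trans; cong; cong₂; subst)
  open import Relation.Nullary using (¬_; contradiction)
  open Sums
  open ShiftedDiscriminant
  open Congruence p
  open CoefficientFormula p-prime using (DistinctNodes)
  open Nonvanishing p-prime
  open Diagonals p-prime
  open DiagonalBlock

  private variable s : ℕ

  ∈-pairsLt : ∀ {i j : Fin s} → i Fin.< j → (i , j) ∈ pairsLt s
  ∈-pairsLt {s} {i} {j} i<j =
    ∈-concatMap⁺ (λ j → map (λ i → (i , j)) (filter (_<? j) (allFin s)))
                 (lose (∈-allFin j) (∈-map⁺ (λ i → (i , j)) (∈-filter⁺ (_<? j) (∈-allFin i) i<j)))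

  pairwise-from-< : ∀ {R : Fin s → Fin s → Set} → (∀ {i j} → R i j → R j i) → (∀ {i j} → i Fin.< j → R i j) →
                    ∀ i j → i ≢ j → R i j
  pairwise-from-< sym-R <⇒R i j i≢j with Fin.<-cmp i j
  ... | tri< i<j _ _ = <⇒R i<j
  ... | tri≈ _ i≡j _ = contradiction i≡j i≢j
  ... | tri> _ _ j<i = sym-R (<⇒R j<i)

  Disjoint-sym : ∀ {x y : Pair p} → Disjoint x y → Disjoint y x
  Disjoint-sym (a≢a′ , b≢b′) = a≢a′ ∘ sym , b≢b′ ∘ sym

  shiftedProduct≉0⇒ : ∀ γ (t : Fin s → ℤ) → shiftedProduct γ (pairsLt s) t ≉ 0ℤ → ∀ {i j} → i Fin.< j →
                      t j - t i ≉ 0ℤ × t j - t i + (γ j - γ i) ≉ 0ℤ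
  shiftedProduct≉0⇒ γ t P≉0 {i} {j} i<j =
    let factor≉0 = ∏≉0⇒≉0 (λ (i , j) → (t j - t i) * (t j - t i + (γ j - γ i))) P≉0 (∈-pairsLt i<j)
    in *≉0⇒≉0ˡ (t j - t i + (γ j - γ i)) factor≉0 , *≉0⇒≉0ʳ (t j - t i) factor≉0

  transversal : ∀ (f : Vec ℕ s) {𝓕 : Fin s → List (Pair p)} → (∀ i → DiagonalBlock (lookup f i) (𝓕 i)) →
                coeff f (discPoly s) ≉ 0ℤ →
                Σ (Fin s → Pair p) (λ F → (∀ i → F i ∈ 𝓕 i) × (∀ i j → ¬ (i ≡ j) → Disjoint (F i) (F j)))
  transversal f {𝓕} B coeff≉0 = F , F∈𝓕 , pairwise-from-< Disjoint-sym disjoint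
    where
      γ = λ i → + shift (B i)
      T = λ i → map first (edges (B i))
      nodes : DistinctNodes f T
      nodes i = distinct-firsts (unique-edges (B i)) (on-diagonal (B i)) ,
                trans (List.length-map first (edges (B i))) (length-edges (B i))
      found = shiftedProduct-nonvanishing f γ nodes coeff≉0
      t = proj₁ found
      t∈T = proj₁ (proj₂ found)
      P[t]≉0 = proj₂ (proj₂ found)
      lift : ∀ i → ∃[ x ] x ∈ edges (B i) × t i ≡ first x
      lift i = ∈-map⁻ first (t∈T i)
      F = λ i → proj₁ (lift i)
      F∈edges = λ i → proj₁ (proj₂ (lift i))
      F∈𝓕 : ∀ i → F i ∈ 𝓕 i
      F∈𝓕 i = All.lookup (edges⊆𝓕 (B i)) (F∈edges i)
      t≡first : ∀ i → t i ≡ first (F i)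
      t≡first i = proj₂ (proj₂ (lift i))
      γ≡diagonal : ∀ i → γ i ≡ + diagonal (F i)
      γ≡diagonal i = cong +_ (sym (All.lookup (on-diagonal (B i)) (F∈edges i)))
      disjoint : ∀ {i j} → i Fin.< j → Disjoint (F i) (F j)
      disjoint {i} {j} i<j =
        let Δt≉0 , Δt+Δγ≉0 = shiftedProduct≉0⇒ γ t P[t]≉0 i<j
            Δt≡Δfirst = cong₂ _-_ (t≡first j) (t≡first i)
        in ≉0⇒Disjoint (F i) (F j) (subst (_≉ 0ℤ) Δt≡Δfirst Δt≉0)
             (subst (_≉ 0ℤ) (cong₂ _+_ Δt≡Δfirst (cong₂ _-_ (γ≡diagonal j) (γ≡diagonal i))) Δt+Δγ≉0)

open import Data.Nat using (_*_; _>_; _≥_)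
open import Data.Integer using (+_)
open import Data.Integer.Divisibility using (_∣_)
open import Data.Fin using (Fin)
open import Data.Vec using (Vec; lookup)
open import Data.List using (List; length)
open import Data.List.Relation.Unary.Unique.Propositional using (Unique)
open import Data.List.Membership.Propositional using (_∈_)
open import Data.Product using (Σ; _×_)
open import Relation.Nullary using (¬_)
open import Relation.Binary.PropositionalEquality using (_≡_)
open import Data.Integer.Divisibility.Signed using (∣⇒∣ᵤ)
open import Function using (_∘_)

theorem3 : (p s : ℕ) → Prime p → s ≥ 1 → (f : Vec ℕ s)
    → ¬ ((+ p) ∣ coeff f (discPoly s))
    → (𝓕 : Fin s → List (Pair p))
    → (∀ i → Unique (𝓕 i))
    → (∀ i → length (𝓕 i) > p * lookup f i)
    → Σ (Fin s → Pair p) (λ F → (∀ i → F i ∈ 𝓕 i) × (∀ i j → ¬ (i ≡ j) → Disjoint (F i) (F j)))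
theorem3 p s p-prime _ f p∤coeff 𝓕 unique large =
  transversal f (λ i → diagonalBlock (unique i) (large i)) (p∤coeff ∘ ∣⇒∣ᵤ ∘ ≈0⇒∣)
  where open Congruence p
        open Diagonals p-prime
        open Transversal p-prime
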